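{- Let $C$ be an arbitrary Boolean circuit (built from $\neg,\vee,\wedge$) with $n$ input variables $p_1,\ldots,p_n$ and one output. Let $p,q_1,\ldots,q_n$ be $n+1$ fresh variables. Let $h(C)$ be the circuit obtained from $C$ by replacing every input variable $p_i$ by $p_i \wedge q_i$, let $D = (\bigwedge_{i=1}^n p_i) \wedge (\bigwedge_{i=1}^n \neg q_i)$, and let \[ F(C) = (p \vee (h(C) + D)) \wedge (\neg p \vee D), \] a circuit in the $2n+1$ variables $p,p_1,\ldots,p_n,q_1,\ldots,q_n$. Let $f : \{0,1\}^{2n+1} \to \{0,1\}$ be the function computed by $F(C)$ (coordinates of $\{0,1\}^{2n+1}$ identified with these $2n+1$ variables). Then $C$ is unsatisfiable if and only if there exists $s \in \{0,1\}^{2n+1}$ with $s \neq \overline{0}$ and $s \in V(f)$.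
   Context: $+$ denotes exclusive or (addition modulo 2) on $\{0,1\}$, and for vectors $x,y \in \{0,1\}^k$, $x+y$ is the coordinatewise exclusive or. $\overline{0}$ is the all-zero vector. For a function $f : \{0,1\}^k \to \{0,1\}^m$, $V(f) = \{ s \in \{0,1\}^k \mid \forall x \in \{0,1\}^k : f(x+s) = f(x)\}$. A circuit with one output is satisfiable if some assignment of Boolean values to its inputs makes the output true. In a formula/circuit, $A + B$ abbreviates $(A \wedge \neg B) \vee (\neg A \wedge B)$. -}

module Defs where

open import Data.Nat using (ℕ; zero; suc; _+_)
open import Data.Fin using (Fin; zero; suc; _↑ˡ_; _↑ʳ_)
open import Data.Bool using (Bool; true; false; not; _∧_; _∨_)
open import Data.Product using (Σ; _,_)
open import Relation.Binary.PropositionalEquality using (_≡_)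

-- Boolean values {0,1} are represented by Bool (false = 0, true = 1).

-- Circ v : a circuit whose wires may refer to v named wires (the inputs,
-- plus the outputs of shared subcircuits introduced by `share`).
-- `share A B` computes A once and lets B refer to its output as wire zero;
-- this gives arbitrary DAG-shaped (fan-out) circuits.  A circuit with n
-- input variables and one output is an element of Circ n.

data Circ (v : ℕ) : Set where
  var   : Fin v → Circ v
  ¬c    : Circ v → Circ v
  _∨c_  : Circ v → Circ v → Circ v
  _∧c_  : Circ v → Circ v → Circ v
  share : Circ v → Circ (suc v) → Circ v

ext : ∀ {v} → Bool → (Fin v → Bool) → Fin (suc v) → Bool
ext b ρ zero    = b
ext b ρ (suc i) = ρ i

eval : ∀ {v} → Circ v → (Fin v → Bool) → Bool
eval (var i)     ρ = ρ i
eval (¬c A)      ρ = not (eval A ρ)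
eval (A ∨c B)    ρ = eval A ρ ∨ eval B ρ
eval (A ∧c B)    ρ = eval A ρ ∧ eval B ρ
eval (share A B) ρ = eval B (ext (eval A ρ) ρ)

Satisfiable : ∀ {n} → Circ n → Set
Satisfiable {n} C = Σ (Fin n → Bool) λ x → eval C x ≡ true

liftR : ∀ {v w} → (Fin v → Fin w) → Fin (suc v) → Fin (suc w)
liftR r zero    = zero
liftR r (suc i) = suc (r i)

rename : ∀ {v w} → (Fin v → Fin w) → Circ v → Circ w
rename r (var i)     = var (r i)
rename r (¬c A)      = ¬c (rename r A)
rename r (A ∨c B)    = rename r A ∨c rename r B
rename r (A ∧c B)    = rename r A ∧c rename r B
rename r (share A B) = share (rename r A) (rename (liftR r) B)

liftS : ∀ {v w} → (Fin v → Circ w) → Fin (suc v) → Circ (suc w)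
liftS σ zero    = var zero
liftS σ (suc i) = rename suc (σ i)

subst : ∀ {v w} → (Fin v → Circ w) → Circ v → Circ w
subst σ (var i)     = σ i
subst σ (¬c A)      = ¬c (subst σ A)
subst σ (A ∨c B)    = subst σ A ∨c subst σ B
subst σ (A ∧c B)    = subst σ A ∧c subst σ B
subst σ (share A B) = share (subst σ A) (subst (liftS σ) B)

-- The 2n+1 variables of F(C), indexed by Fin (suc (n + n)):
--   zero          ↦ p
--   suc (i ↑ˡ n)  ↦ p_i
--   suc (n ↑ʳ i)  ↦ q_i

pV : ∀ n → Fin (suc (n + n))
pV n = zero

piV : ∀ n → Fin n → Fin (suc (n + n))
piV n i = suc (i ↑ˡ n)

qiV : ∀ n → Fin n → Fin (suc (n + n))
qiV n i = suc (n ↑ʳ i)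

_+c_ : ∀ {v} → Circ v → Circ v → Circ v
A +c B = (A ∧c ¬c B) ∨c (¬c A ∧c B)

-- big conjunction of a family of n circuits; the empty conjunction
-- (n = 0) is the constant true, realised as  p ∨ ¬p  on a given wire.
bigAnd : ∀ {v} (n : ℕ) → Circ v → (Fin n → Circ v) → Circ v
bigAnd zero       t φ = t
bigAnd (suc zero) t φ = φ zero
bigAnd (suc (suc n)) t φ = φ zero ∧c bigAnd (suc n) t (λ i → φ (suc i))

h : ∀ {n} → Circ n → Circ (suc (n + n))
h {n} C = subst (λ i → var (piV n i) ∧c var (qiV n i)) C

D : ∀ n → Circ (suc (n + n))
D n = bigAnd n T (λ i → var (piV n i)) ∧c bigAnd n T (λ i → ¬c (var (qiV n i)))
  where T = var (pV n) ∨c ¬c (var (pV n))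

F : ∀ {n} → Circ n → Circ (suc (n + n))
F {n} C = (var (pV n) ∨c (h C +c D n)) ∧c (¬c (var (pV n)) ∨c D n)

Point : ℕ → Set
Point k = Fin k → Bool

_⊕_ : ∀ {k} → Point k → Point k → Point k
(x ⊕ y) i = x i Data.Bool.xor y i

zeroP : ∀ {k} → Point k
zeroP i = false

NonZeroP : ∀ {k} → Point k → Set
NonZeroP {k} s = Σ (Fin k) λ i → s i ≡ true

InV : ∀ {k} → (Point k → Bool) → Point k → Set
InV {k} f s = ∀ (x : Point k) → f (x ⊕ s) ≡ f x

-- For p = 1 the circuit F(C) computes D and for p = 0 it computes h(C) + D,
-- where D holds exactly when (p_1..p_n, q_1..q_n) is d = (1..1, 0..0).
-- If C is unsatisfiable then h(C) ≡ 0, so F(C) = D ignores p and the unit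
-- vector in direction p is a period.  Conversely let s ≠ 0 be a period.  If
-- s_p = 0, shifting (1, d) by s must stay at (1, d), forcing s = 0.  So s_p = 1,
-- and every x with p = 0 and F(C)(x) = 1 satisfies x + s = (1, d), which fixes
-- the q-coordinates of x.  If C(a) = 1 and n ≥ 1, two such x differ at q_1:
-- (0, a, 1..1) and (0, b..b, 0..0) with b = ¬C(0̄).  If n = 0 then D ≡ 1, and
-- F(C) is 0 at p = 0 but 1 at p = 1.
module Submission where

open import Defs
open import Data.Nat using (ℕ; zero; suc; _+_)
open import Data.Fin using (Fin; zero; suc; splitAt)
open import Data.Fin.Properties using (splitAt-↑ˡ; splitAt-↑ʳ; splitAt⁻¹-↑ˡ; splitAt⁻¹-↑ʳ)
open import Data.Bool using (Bool; true; false; not; _∧_; _∨_; _xor_)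
open import Data.Bool.Properties
  using (∧-identityʳ; ∧-zeroʳ; ∨-identityʳ; ∨-inverseʳ; not-involutive; xor-identityʳ; xor-inverseʳ; ¬-not)
open import Data.Product using (Σ; _×_; _,_; proj₁; proj₂)
open import Data.Sum using (inj₁; inj₂; [_,_])
open import Function.Base using (const)
open import Function.Bundles using (_⇔_; mk⇔; Equivalence)
open import Relation.Nullary using (¬_; contradiction)
open import Relation.Binary.PropositionalEquality
  using (_≡_; refl; sym; trans; cong; cong₂)
open Relation.Binary.PropositionalEquality.≡-Reasoning

∧-≡-true : ∀ {a b} → a ∧ b ≡ true → a ≡ true × b ≡ true
∧-≡-true {true} b≡true = refl , b≡true

xor-disjunctive-form : ∀ a b → (a ∧ not b) ∨ (not a ∧ b) ≡ a xor b
xor-disjunctive-form true  b = ∨-identityʳ (not b)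
xor-disjunctive-form false b = refl

xor-cancelˡ : ∀ a {b c} → a xor b ≡ c → b ≡ a xor c
xor-cancelˡ true  refl = sym (not-involutive _)
xor-cancelˡ false refl = refl

eval-cong : ∀ {v} (A : Circ v) {ρ ρ′ : Fin v → Bool} →
  (∀ i → ρ i ≡ ρ′ i) → eval A ρ ≡ eval A ρ′
eval-cong (var i)     ρ≗ρ′ = ρ≗ρ′ i
eval-cong (¬c A)      ρ≗ρ′ = cong not (eval-cong A ρ≗ρ′)
eval-cong (A ∨c B)    ρ≗ρ′ = cong₂ _∨_ (eval-cong A ρ≗ρ′) (eval-cong B ρ≗ρ′)
eval-cong (A ∧c B)    ρ≗ρ′ = cong₂ _∧_ (eval-cong A ρ≗ρ′) (eval-cong B ρ≗ρ′)
eval-cong (share A B) ρ≗ρ′ = eval-cong B λ where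
  zero    → eval-cong A ρ≗ρ′
  (suc i) → ρ≗ρ′ i

eval-rename : ∀ {v w} (r : Fin v → Fin w) (A : Circ v) (ρ : Fin w → Bool) →
  eval (rename r A) ρ ≡ eval A (λ i → ρ (r i))
eval-rename r (var i)     ρ = refl
eval-rename r (¬c A)      ρ = cong not (eval-rename r A ρ)
eval-rename r (A ∨c B)    ρ = cong₂ _∨_ (eval-rename r A ρ) (eval-rename r B ρ)
eval-rename r (A ∧c B)    ρ = cong₂ _∧_ (eval-rename r A ρ) (eval-rename r B ρ)
eval-rename r (share A B) ρ = trans (eval-rename (liftR r) B _) (eval-cong B λ where
  zero    → eval-rename r A ρ
  (suc i) → refl)

eval-subst : ∀ {v w} (σ : Fin v → Circ w) (A : Circ v) (ρ : Fin w → Bool) →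
  eval (subst σ A) ρ ≡ eval A (λ i → eval (σ i) ρ)
eval-subst σ (var i)     ρ = refl
eval-subst σ (¬c A)      ρ = cong not (eval-subst σ A ρ)
eval-subst σ (A ∨c B)    ρ = cong₂ _∨_ (eval-subst σ A ρ) (eval-subst σ B ρ)
eval-subst σ (A ∧c B)    ρ = cong₂ _∧_ (eval-subst σ A ρ) (eval-subst σ B ρ)
eval-subst σ (share A B) ρ = trans (eval-subst (liftS σ) B _) (eval-cong B λ where
  zero    → eval-subst σ A ρ
  (suc i) → eval-rename suc (σ i) _)

eval-+c : ∀ {v} (A B : Circ v) ρ → eval (A +c B) ρ ≡ eval A ρ xor eval B ρ
eval-+c A B ρ = xor-disjunctive-form (eval A ρ) (eval B ρ)

bigAnd-intro : ∀ {v} n (t : Circ v) (φ : Fin n → Circ v) ρ →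
  eval t ρ ≡ true → (∀ i → eval (φ i) ρ ≡ true) → eval (bigAnd n t φ) ρ ≡ true
bigAnd-intro zero          t φ ρ t≡true φ≡true = t≡true
bigAnd-intro (suc zero)    t φ ρ t≡true φ≡true = φ≡true zero
bigAnd-intro (suc (suc n)) t φ ρ t≡true φ≡true =
  cong₂ _∧_ (φ≡true zero) (bigAnd-intro (suc n) t (λ i → φ (suc i)) ρ t≡true (λ i → φ≡true (suc i)))

bigAnd-elim : ∀ {v} n (t : Circ v) (φ : Fin n → Circ v) ρ →
  eval (bigAnd n t φ) ρ ≡ true → ∀ i → eval (φ i) ρ ≡ true
bigAnd-elim (suc zero)    t φ ρ ⋀≡true zero    = ⋀≡true
bigAnd-elim (suc (suc n)) t φ ρ ⋀≡true zero    = proj₁ (∧-≡-true ⋀≡true)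
bigAnd-elim (suc (suc n)) t φ ρ ⋀≡true (suc i) =
  bigAnd-elim (suc n) t (λ i → φ (suc i)) ρ (proj₂ (∧-≡-true ⋀≡true)) i

bigAnd-cong : ∀ {v} n (t : Circ v) (φ : Fin n → Circ v) {ρ ρ′} →
  eval t ρ ≡ eval t ρ′ → (∀ i → eval (φ i) ρ ≡ eval (φ i) ρ′) →
  eval (bigAnd n t φ) ρ ≡ eval (bigAnd n t φ) ρ′
bigAnd-cong zero          t φ t≡ φ≡ = t≡
bigAnd-cong (suc zero)    t φ t≡ φ≡ = φ≡ zero
bigAnd-cong (suc (suc n)) t φ t≡ φ≡ =
  cong₂ _∧_ (φ≡ zero) (bigAnd-cong (suc n) t (λ i → φ (suc i)) t≡ (λ i → φ≡ (suc i)))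

eval-h : ∀ {n} (C : Circ n) ρ → eval (h C) ρ ≡ eval C (λ i → ρ (piV n i) ∧ ρ (qiV n i))
eval-h C = eval-subst _ C

SatisfiesD : ∀ n → Point (suc (n + n)) → Set
SatisfiesD n ρ = (∀ i → ρ (piV n i) ≡ true) × (∀ i → ρ (qiV n i) ≡ false)

eval-D : ∀ n ρ → eval (D n) ρ ≡ true ⇔ SatisfiesD n ρ
eval-D n ρ = mk⇔
  (λ D≡true → let ⋀p≡true , ⋀¬q≡true = ∧-≡-true D≡true in
    bigAnd-elim n T ps ρ ⋀p≡true ,
    λ i → trans (sym (not-involutive _)) (cong not (bigAnd-elim n T ¬qs ρ ⋀¬q≡true i)))
  (λ (p≡true , q≡false) → cong₂ _∧_
    (bigAnd-intro n T ps ρ (∨-inverseʳ (ρ (pV n))) p≡true)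
    (bigAnd-intro n T ¬qs ρ (∨-inverseʳ (ρ (pV n))) (λ i → cong not (q≡false i))))
  where
  T = var (pV n) ∨c ¬c (var (pV n))
  ps ¬qs : Fin n → Circ (suc (n + n))
  ps i = var (piV n i)
  ¬qs i = ¬c (var (qiV n i))

eval-D-false : ∀ n ρ → ¬ SatisfiesD n ρ → eval (D n) ρ ≡ false
eval-D-false n ρ ¬sat = ¬-not (λ D≡true → ¬sat (Equivalence.to (eval-D n ρ) D≡true))

eval-D-cong : ∀ n {ρ ρ′} →
  (∀ i → ρ (piV n i) ≡ ρ′ (piV n i)) → (∀ i → ρ (qiV n i) ≡ ρ′ (qiV n i)) →
  eval (D n) ρ ≡ eval (D n) ρ′
eval-D-cong n {ρ} {ρ′} p≗ q≗ = cong₂ _∧_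
  (bigAnd-cong n T (λ i → var (piV n i)) T≡ p≗)
  (bigAnd-cong n T (λ i → ¬c (var (qiV n i))) T≡ (λ i → cong not (q≗ i)))
  where
  T = var (pV n) ∨c ¬c (var (pV n))
  T≡ : eval T ρ ≡ eval T ρ′
  T≡ = trans (∨-inverseʳ (ρ (pV n))) (sym (∨-inverseʳ (ρ′ (pV n))))

F-at-p-true : ∀ {n} (C : Circ n) ρ → ρ (pV n) ≡ true → eval (F C) ρ ≡ eval (D n) ρ
F-at-p-true C ρ p≡true rewrite p≡true = refl

F-at-p-false : ∀ {n} (C : Circ n) ρ → ρ (pV n) ≡ false →
  eval (F C) ρ ≡ eval (h C) ρ xor eval (D n) ρ
F-at-p-false {n} C ρ p≡false rewrite p≡false = trans (∧-identityʳ _) (eval-+c (h C) (D n) ρ)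

point : ∀ n → Bool → (Fin n → Bool) → (Fin n → Bool) → Point (suc (n + n))
point n b x y zero    = b
point n b x y (suc j) = [ x , y ] (splitAt n j)

point-piV : ∀ n b x y i → point n b x y (piV n i) ≡ x i
point-piV n b x y i rewrite splitAt-↑ˡ n i n = refl

point-qiV : ∀ n b x y i → point n b x y (qiV n i) ≡ y i
point-qiV n b x y i rewrite splitAt-↑ʳ n n i = refl

eval-h-point : ∀ {n} (C : Circ n) b x y →
  eval (h C) (point n b x y) ≡ eval C (λ i → x i ∧ y i)
eval-h-point {n} C b x y =
  trans (eval-h C _) (eval-cong C (λ i → cong₂ _∧_ (point-piV n b x y i) (point-qiV n b x y i)))

data Coordinate (n : ℕ) : Fin (suc (n + n)) → Set where
  at-p  : Coordinate n (pV n)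
  at-pᵢ : ∀ i → Coordinate n (piV n i)
  at-qᵢ : ∀ i → Coordinate n (qiV n i)

coordinate : ∀ n k → Coordinate n k
coordinate n zero = at-p
coordinate n (suc j) with splitAt n j in eq
... | inj₁ i rewrite sym (splitAt⁻¹-↑ˡ eq) = at-pᵢ i
... | inj₂ i rewrite sym (splitAt⁻¹-↑ʳ eq) = at-qᵢ i

coordinates-false⇒¬NonZeroP : ∀ {n} {s : Point (suc (n + n))} → s (pV n) ≡ false →
  (∀ i → s (piV n i) ≡ false) → (∀ i → s (qiV n i) ≡ false) → ¬ NonZeroP s
coordinates-false⇒¬NonZeroP {n} sp sp′ sq (k , sk≡true) with coordinate n k
... | at-p    = contradiction (trans (sym sk≡true) sp) λ ()
... | at-pᵢ i = contradiction (trans (sym sk≡true) (sp′ i)) λ ()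
... | at-qᵢ i = contradiction (trans (sym sk≡true) (sq i)) λ ()

unit-p : ∀ n → Point (suc (n + n))
unit-p n zero    = true
unit-p n (suc _) = false

unsatisfiable⇒F≗D : ∀ {n} (C : Circ n) → ¬ Satisfiable C → ∀ ρ → eval (F C) ρ ≡ eval (D n) ρ
unsatisfiable⇒F≗D {n} C unsat ρ = by-p (ρ (pV n)) refl
  where
  h≡false = ¬-not (λ h≡true → unsat (_ , trans (sym (eval-h C ρ)) h≡true))
  by-p : ∀ b → ρ (pV n) ≡ b → eval (F C) ρ ≡ eval (D n) ρ
  by-p true  p≡true  = F-at-p-true C ρ p≡true
  by-p false p≡false = trans (F-at-p-false C ρ p≡false) (cong (_xor eval (D n) ρ) h≡false)

unit-p-period : ∀ {n} (C : Circ n) → ¬ Satisfiable C → InV (eval (F C)) (unit-p n)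
unit-p-period {n} C unsat x = begin
  eval (F C) (x ⊕ unit-p n) ≡⟨ unsatisfiable⇒F≗D C unsat _ ⟩
  eval (D n) (x ⊕ unit-p n) ≡⟨ eval-D-cong n (λ _ → xor-identityʳ _) (λ _ → xor-identityʳ _) ⟩
  eval (D n) x              ≡⟨ unsatisfiable⇒F≗D C unsat x ⟨
  eval (F C) x              ∎

module _ {n} (C : Circ n) {s : Point (suc (n + n))} (period : InV (eval (F C)) s) where

  shift-satisfies-D : ∀ x → (x ⊕ s) (pV n) ≡ true → eval (F C) x ≡ true →
    SatisfiesD n (x ⊕ s)
  shift-satisfies-D x p≡true Fx≡true = Equivalence.to (eval-D n (x ⊕ s)) (begin
    eval (D n) (x ⊕ s) ≡⟨ F-at-p-true C (x ⊕ s) p≡true ⟨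
    eval (F C) (x ⊕ s) ≡⟨ period x ⟩
    eval (F C) x       ≡⟨ Fx≡true ⟩
    true               ∎)

  period-p : NonZeroP s → s (pV n) ≡ true
  period-p nz = ¬-not λ sp≡false →
    let sat = shift-satisfies-D d (cong (true xor_) sp≡false) Fd≡true in
    coordinates-false⇒¬NonZeroP sp≡false
      (λ i → trans (xor-cancelˡ (d (piV n i)) (proj₁ sat i)) (cong (_xor true) (d-piV i)))
      (λ i → trans (xor-cancelˡ (d (qiV n i)) (proj₂ sat i)) (cong (_xor false) (d-qiV i)))
      nz
    where
    d : Point (suc (n + n))
    d = point n true (const true) (const false)
    d-piV : ∀ i → d (piV n i) ≡ true
    d-piV = point-piV n true (const true) (const false)
    d-qiV : ∀ i → d (qiV n i) ≡ false
    d-qiV = point-qiV n true (const true) (const false)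
    Fd≡true : eval (F C) d ≡ true
    Fd≡true = trans (F-at-p-true C d refl) (Equivalence.from (eval-D n d) (d-piV , d-qiV))

  period-q-coordinates : s (pV n) ≡ true → ∀ x → x (pV n) ≡ false → eval (F C) x ≡ true →
    ∀ i → s (qiV n i) ≡ x (qiV n i)
  period-q-coordinates sp x xp Fx≡true i =
    trans (xor-cancelˡ (x (qiV n i)) (proj₂ (shift-satisfies-D x (cong₂ _xor_ xp sp) Fx≡true) i))
          (xor-identityʳ _)

h-at-witness : ∀ {n} (C : Circ n) b a → eval C a ≡ true →
  eval (h C) (point n b a (const true)) ≡ true
h-at-witness C b a Ca≡true =
  trans (eval-h-point C b a _) (trans (eval-cong C (λ i → ∧-identityʳ (a i))) Ca≡true)

D-at-constant : ∀ m b₀ b → eval (D (suc m)) (point (suc m) b₀ (const b) (const false)) ≡ b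
D-at-constant m b₀ true  =
  Equivalence.from (eval-D (suc m) _) (point-piV (suc m) b₀ _ _ , point-qiV (suc m) b₀ _ _)
D-at-constant m b₀ false = eval-D-false (suc m) _ λ (p≡true , _) →
  contradiction (trans (sym (point-piV (suc m) b₀ (const false) (const false) zero)) (p≡true zero)) λ ()

period-through-p⇒unsatisfiable : ∀ n (C : Circ n) {s} →
  InV (eval (F C)) s → s (pV n) ≡ true → ¬ Satisfiable C
period-through-p⇒unsatisfiable zero C {s} period sp (a , Ca≡true) = contradiction (begin
  true                          ≡⟨ D-true (x ⊕ s) ⟨
  eval (D 0) (x ⊕ s)            ≡⟨ F-at-p-true C (x ⊕ s) sp ⟨
  eval (F C) (x ⊕ s)            ≡⟨ period x ⟩
  eval (F C) x                  ≡⟨ F-at-p-false C x refl ⟩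
  eval (h C) x xor eval (D 0) x ≡⟨ cong₂ _xor_ (h-at-witness C false a Ca≡true) (D-true x) ⟩
  false                         ∎) λ ()
  where
  x : Point 1
  x = point 0 false a (const true)
  D-true : ∀ ρ → eval (D 0) ρ ≡ true
  D-true ρ = Equivalence.from (eval-D 0 ρ) ((λ ()) , (λ ()))
period-through-p⇒unsatisfiable (suc m) C {s} period sp (a , Ca≡true) = contradiction (begin
  true            ≡⟨ point-qiV n false a _ zero ⟨
  x₁ (qiV n zero) ≡⟨ period-q-coordinates C period sp x₁ refl Fx₁≡true zero ⟨
  s (qiV n zero)  ≡⟨ period-q-coordinates C period sp x₂ refl Fx₂≡true zero ⟩
  x₂ (qiV n zero) ≡⟨ point-qiV n false _ _ zero ⟩
  false           ∎) λ ()
  where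
  n = suc m
  x₁ x₂ : Point (suc (n + n))
  x₁ = point n false a (const true)
  Fx₁≡true : eval (F C) x₁ ≡ true
  Fx₁≡true = trans (F-at-p-false C x₁ refl) (cong₂ _xor_ (h-at-witness C false a Ca≡true)
    (eval-D-false n x₁ λ (_ , q≡false) →
      contradiction (trans (sym (point-qiV n false a _ zero)) (q≡false zero)) λ ()))
  c = eval C (const false)
  x₂ = point n false (const (not c)) (const false)
  Fx₂≡true : eval (F C) x₂ ≡ true
  Fx₂≡true = begin
    eval (F C) x₂                   ≡⟨ F-at-p-false C x₂ refl ⟩
    eval (h C) x₂ xor eval (D n) x₂ ≡⟨ cong₂ _xor_ hx₂≡c (D-at-constant m false (not c)) ⟩
    c xor not c                     ≡⟨ xor-inverseʳ c ⟩
    true                            ∎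
    where hx₂≡c = trans (eval-h-point C false _ _) (eval-cong C (λ _ → ∧-zeroʳ _))

theorem1 : (n : ℕ) (C : Circ n) →
    (¬ Satisfiable C) ⇔ Σ (Point (suc (n + n))) (λ s → NonZeroP s × InV (eval (F C)) s)
theorem1 n C = mk⇔
  (λ unsat → unit-p n , (zero , refl) , unit-p-period C unsat)
  (λ (s , nonzero , period) →
    period-through-p⇒unsatisfiable n C period (period-p C period nonzero))
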